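{- Let $G$ be a connected graph of order $n$ without isolated vertices. Then $\chi_d^t(G)\leq n+1-\alpha_0(G)$.
   Context: All graphs are finite, simple and undirected. A total dominator coloring of a graph $G$ is a proper vertex coloring of $G$ in which each vertex of $G$ is adjacent to every vertex of some color class (a color class is the set of all vertices receiving a given color). The total dominator chromatic number $\chi_d^t(G)$ is the minimum number of color classes in a total dominator coloring of $G$. For a graph $G=(V,E)$, consider independent vertex sets $S\subseteq V$ such that the induced subgraph $G[V-S]$ has no isolated vertex, or every isolated vertex of $G[V-S]$ is adjacent to all vertices of $S$; $\alpha_0(G)$ denotes the maximum cardinality of such a set $S$. -}

module Defs where

open import Data.Nat using (ℕ; _≤_)
open import Data.Fin using (Fin)
open import Data.Fin.Subset using (Subset; _∈_; _∉_; ∣_∣)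
open import Data.Product using (Σ; ∃; _×_; _,_)
open import Data.Sum using (_⊎_)
open import Relation.Nullary using (¬_)
open import Relation.Binary.PropositionalEquality using (_≡_)
open import Level using (0ℓ)

record Graph (n : ℕ) : Set₁ where
  field
    Adj    : Fin n → Fin n → Set
    sym    : ∀ {u v} → Adj u v → Adj v u
    irrefl : ∀ {u} → ¬ Adj u u
open Graph public

module _ {n : ℕ} (G : Graph n) where

  data Reach : Fin n → Fin n → Set where
    here : ∀ {u} → Reach u u
    step : ∀ {u w v} → Adj G u w → Reach w v → Reach u v

  Connected : Set
  Connected = ∀ u v → Reach u v

  NoIsolated : Set
  NoIsolated = ∀ v → ∃ λ u → Adj G v u

  IsProperColoring : (k : ℕ) → (Fin n → Fin k) → Set
  IsProperColoring k c =
    (∀ u v → Adj G u v → ¬ (c u ≡ c v)) × (∀ i → ∃ λ v → c v ≡ i)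

  IsTotalDominatorColoring : (k : ℕ) → (Fin n → Fin k) → Set
  IsTotalDominatorColoring k c =
    IsProperColoring k c ×
    (∀ v → Σ (Fin k) λ i → ∀ u → c u ≡ i → Adj G v u)

  HasTDC : ℕ → Set
  HasTDC k = Σ (Fin n → Fin k) λ c → IsTotalDominatorColoring k c

  IsTotalDominatorChromaticNumber : ℕ → Set
  IsTotalDominatorChromaticNumber k = HasTDC k × (∀ m → HasTDC m → k ≤ m)

  Independent : Subset n → Set
  Independent S = ∀ u v → u ∈ S → v ∈ S → ¬ Adj G u v

  IsolatedIn-V∖ : Subset n → Fin n → Set
  IsolatedIn-V∖ S v = v ∉ S × (∀ u → u ∉ S → ¬ Adj G v u)

  Admissible : Subset n → Set
  Admissible S =
    Independent S ×
    ((∀ v → ¬ IsolatedIn-V∖ S v)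
     ⊎ (∀ v → IsolatedIn-V∖ S v → ∀ s → s ∈ S → Adj G v s))

  IsAlpha0 : ℕ → Set
  IsAlpha0 a = (Σ (Subset n) λ S → Admissible S × ∣ S ∣ ≡ a)
             × (∀ S → Admissible S → ∣ S ∣ ≤ a)

module Submission where

-- Let S be an admissible set realising α₀(G).  Give every
-- vertex of S the colour 0 and every vertex outside S a colour of its own.
-- This is proper because S is independent, and it is total dominating:
-- a vertex with a neighbour u outside S dominates the singleton class {u};
-- a vertex without such a neighbour cannot lie in S (it has a neighbour,
-- which would then lie in the independent set S), so it is isolated in
-- G[V - S] and hence, by admissibility, adjacent to the whole class S.
-- The colouring uses 1 + |V - S| = n + 1 - |S| colours.  When S is empty
-- colour 0 would be unused; then we use the admissible singleton {0}
-- instead (or the empty colouring if n = 0), which gives χ ≤ n + 1.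
--
-- Adjacency is an
-- arbitrary relation, so the case analysis "has v a neighbour outside S?"
-- is only available under a double negation; since the goal is a
-- decidable inequality of naturals, that suffices.

open import Defs hiding (sym)
open import Data.Nat using (ℕ; zero; suc; _≤_; _+_; _∸_; z≤n; _≤?_)
open import Data.Nat.Properties using (+-comm; +-∸-assoc; m∸n≤m; ≤-trans)
open import Data.Fin using (Fin; zero; suc; punchIn)
open import Data.Fin.Properties using (punchIn-injective; punchInᵢ≢i)
open import Data.Fin.Subset using (Subset; inside; outside; _∈_; _∉_; ∣_∣; ∁; ⁅_⁆; Nonempty)
open import Data.Fin.Subset.Properties
  using (_∈?_; nonempty?; x∈⁅x⁆; x∈⁅y⁆⇒x≡y; ∣p∣≤n; ∣∁p∣≡n∸∣p∣; Empty-unique; ∣⊥∣≡0)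
open import Data.Vec using (_∷_; here; there)
open import Data.Product using (Σ; ∃; _×_; _,_)
open import Data.Sum using (_⊎_; inj₁; inj₂)
open import Relation.Nullary using (¬_; Dec; yes; no; contradiction)
open import Relation.Nullary.Decidable using (decidable-stable; ¬¬-excluded-middle)
open import Relation.Nullary.Negation using (¬¬-map)
open import Relation.Binary.PropositionalEquality using (_≡_; refl; sym; trans; cong; subst)
open Relation.Binary.PropositionalEquality.≡-Reasoning

¬¬-∀-Fin : ∀ {n} {P : Fin n → Set} → (∀ i → ¬ ¬ P i) → ¬ ¬ (∀ i → P i)
¬¬-∀-Fin {zero}  h k = k (λ ())
¬¬-∀-Fin {suc n} h k =
  h zero λ p₀ → ¬¬-∀-Fin (λ i → h (suc i)) λ pₛ →
    k λ { zero → p₀ ; (suc i) → pₛ i }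

-- The colour map of a subset p: members of p go to 0, and the vertices
-- outside p are numbered injectively by the colours 1, …, ∣ ∁ p ∣.
-- (punchIn 1 fixes 0 and shifts every other colour up by one.)
collapse : ∀ {n} (p : Subset n) → Fin n → Fin (suc ∣ ∁ p ∣)
collapse (inside  ∷ p) zero    = zero
collapse (inside  ∷ p) (suc v) = collapse p v
collapse (outside ∷ p) zero    = suc zero
collapse (outside ∷ p) (suc v) = punchIn (suc zero) (collapse p v)

collapse-∈ : ∀ {n} (p : Subset n) {v} → v ∈ p → collapse p v ≡ zero
collapse-∈ (inside  ∷ p) here        = refl
collapse-∈ (inside  ∷ p) (there v∈p) = collapse-∈ p v∈p
collapse-∈ (outside ∷ p) (there v∈p) = cong (punchIn (suc zero)) (collapse-∈ p v∈p)

collapse-zero : ∀ {n} (p : Subset n) v → collapse p v ≡ zero → v ∈ p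
collapse-zero (inside  ∷ p) zero    _  = here
collapse-zero (inside  ∷ p) (suc v) eq = there (collapse-zero p v eq)
collapse-zero (outside ∷ p) (suc v) eq =
  there (collapse-zero p v (punchIn-injective (suc zero) (collapse p v) zero eq))

collapse-outside : ∀ {n} (p : Subset n) u v → u ∉ p → collapse p u ≡ collapse p v → u ≡ v
collapse-outside (inside ∷ p) zero _ u∉p _ = contradiction here u∉p
collapse-outside (inside ∷ p) (suc u) zero u∉p eq = contradiction (there (collapse-zero p u eq)) u∉p
collapse-outside (inside ∷ p) (suc u) (suc v) u∉p eq =
  cong suc (collapse-outside p u v (λ u∈p → u∉p (there u∈p)) eq)
collapse-outside (outside ∷ p) zero zero _ _ = refl
collapse-outside (outside ∷ p) zero (suc v) _ eq =
  contradiction (sym eq) (punchInᵢ≢i (suc zero) (collapse p v))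
collapse-outside (outside ∷ p) (suc u) zero _ eq =
  contradiction eq (punchInᵢ≢i (suc zero) (collapse p u))
collapse-outside (outside ∷ p) (suc u) (suc v) u∉p eq =
  cong suc (collapse-outside p u v (λ u∈p → u∉p (there u∈p))
    (punchIn-injective (suc zero) (collapse p u) (collapse p v) eq))

collapse-hits : ∀ {n} (p : Subset n) (j : Fin ∣ ∁ p ∣) → ∃ λ v → collapse p v ≡ suc j
collapse-hits (inside ∷ p) j with collapse-hits p j
... | v , eq = suc v , eq
collapse-hits (outside ∷ p) zero = zero , refl
collapse-hits (outside ∷ p) (suc j) with collapse-hits p j
... | v , eq = suc v , cong (punchIn (suc zero)) eq

colour-count : ∀ {n} (p : Subset n) → suc ∣ ∁ p ∣ ≡ n + 1 ∸ ∣ p ∣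
colour-count {n} p = begin
  suc ∣ ∁ p ∣        ≡⟨ cong suc (∣∁p∣≡n∸∣p∣ p) ⟩
  suc (n ∸ ∣ p ∣)    ≡⟨ sym (+-∸-assoc 1 (∣p∣≤n p)) ⟩
  suc n ∸ ∣ p ∣      ≡⟨ cong (_∸ ∣ p ∣) (+-comm 1 n) ⟩
  n + 1 ∸ ∣ p ∣      ∎

module _ {n : ℕ} (G : Graph n) where

  NeighbourOutside : Subset n → Fin n → Set
  NeighbourOutside S v = ∃ λ u → u ∉ S × Adj G v u

  -- Adjacency need not be decidable, but excluded middle holds for all
  -- (finitely many) vertices at once under a double negation.
  ¬¬-decide-neighbours : ∀ S → ¬ ¬ (∀ v → Dec (NeighbourOutside S v))
  ¬¬-decide-neighbours S = ¬¬-∀-Fin (λ v → ¬¬-excluded-middle)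

  collapse-is-TDC : NoIsolated G → ∀ {S} → Admissible G S → Nonempty S →
    (∀ v → Dec (NeighbourOutside S v)) →
    IsTotalDominatorColoring G (suc ∣ ∁ S ∣) (collapse S)
  collapse-is-TDC noIsolated {S} (independent , isolatedCase) (s , s∈S) neighbour? =
    (proper , surjective) , dominating
    where
    proper : ∀ u v → Adj G u v → ¬ (collapse S u ≡ collapse S v)
    proper u v uv eq with u ∈? S
    ... | yes u∈S = independent u v u∈S
                      (collapse-zero S v (trans (sym eq) (collapse-∈ S u∈S))) uv
    ... | no  u∉S = irrefl G (subst (Adj G u) (sym (collapse-outside S u v u∉S eq)) uv)

    surjective : ∀ i → ∃ λ v → collapse S v ≡ i
    surjective zero    = s , collapse-∈ S s∈S
    surjective (suc j) = collapse-hits S j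

    -- Without neighbours outside S, v lies outside S (S is independent and
    -- v has some neighbour) and is isolated in G[V - S].
    isolated : ∀ v → ¬ NeighbourOutside S v → IsolatedIn-V∖ G S v
    isolated v none = v∉S , λ u u∉S vu → none (u , u∉S , vu)
      where
      v∉S : v ∉ S
      v∉S v∈S with noIsolated v
      ... | u , vu with u ∈? S
      ...   | yes u∈S = independent v u v∈S u∈S vu
      ...   | no  u∉S = none (u , u∉S , vu)

    dominating : ∀ v → Σ (Fin (suc ∣ ∁ S ∣)) λ i → ∀ u → collapse S u ≡ i → Adj G v u
    dominating v with neighbour? v
    ... | yes (u , u∉S , vu) =
          collapse S u , λ w eq → subst (Adj G v) (collapse-outside S u w u∉S (sym eq)) vu
    ... | no none = dominatedByS isolatedCase
      where
      dominatedByS : (∀ v → ¬ IsolatedIn-V∖ G S v)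
                     ⊎ (∀ v → IsolatedIn-V∖ G S v → ∀ s → s ∈ S → Adj G v s) →
                     Σ (Fin (suc ∣ ∁ S ∣)) λ i → ∀ u → collapse S u ≡ i → Adj G v u
      dominatedByS (inj₁ noneIsolated) = contradiction (isolated v none) (noneIsolated v)
      dominatedByS (inj₂ adjacentToS)  =
        zero , λ w eq → adjacentToS v (isolated v none) w (collapse-zero S w eq)

  singleton-admissible : NoIsolated G → ∀ s → Admissible G ⁅ s ⁆
  singleton-admissible noIsolated s = independent , inj₂ adjacentToS
    where
    independent : ∀ u v → u ∈ ⁅ s ⁆ → v ∈ ⁅ s ⁆ → ¬ Adj G u v
    independent u v u∈ v∈ with x∈⁅y⁆⇒x≡y s u∈ | x∈⁅y⁆⇒x≡y s v∈
    ... | refl | refl = irrefl G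

    adjacentToS : ∀ v → IsolatedIn-V∖ G ⁅ s ⁆ v → ∀ t → t ∈ ⁅ s ⁆ → Adj G v t
    adjacentToS v (_ , isolated) t t∈ with noIsolated v
    ... | u , vu with u ∈? ⁅ s ⁆
    ...   | yes u∈ = subst (Adj G v) (trans (x∈⁅y⁆⇒x≡y s u∈) (sym (x∈⁅y⁆⇒x≡y s t∈))) vu
    ...   | no  u∉ = contradiction vu (isolated u u∉)

  nonempty-bound : NoIsolated G → ∀ {χ} → (∀ k → HasTDC G k → χ ≤ k) →
    ∀ {S} → Admissible G S → Nonempty S → ¬ ¬ (χ ≤ n + 1 ∸ ∣ S ∣)
  nonempty-bound noIsolated {χ} minimal {S} admissible nonempty =
    ¬¬-map (λ neighbour? → subst (χ ≤_) (colour-count S)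
             (minimal _ (collapse S , collapse-is-TDC noIsolated admissible nonempty neighbour?)))
           (¬¬-decide-neighbours S)

bound-n+1 : ∀ n (G : Graph n) → NoIsolated G → ∀ {χ} → (∀ k → HasTDC G k → χ ≤ k) →
  ¬ ¬ (χ ≤ n + 1)
bound-n+1 zero G _ minimal k = k (≤-trans (minimal 0 emptyColouring) z≤n)
  where
  emptyColouring : HasTDC G 0
  emptyColouring = (λ ()) , ((λ ()) , (λ ())) , (λ ())
bound-n+1 (suc m) G noIsolated minimal =
  ¬¬-map (λ χ≤ → ≤-trans χ≤ (m∸n≤m _ ∣ ⁅ zero {m} ⁆ ∣))
    (nonempty-bound G noIsolated minimal (singleton-admissible G noIsolated zero) (zero , x∈⁅x⁆ zero))

admissible-bound : ∀ n (G : Graph n) → NoIsolated G → ∀ {χ} → (∀ k → HasTDC G k → χ ≤ k) →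
  ∀ {S} → Admissible G S → ¬ ¬ (χ ≤ n + 1 ∸ ∣ S ∣)
admissible-bound n G noIsolated {χ} minimal {S} admissible with nonempty? S
... | yes nonempty = nonempty-bound G noIsolated minimal admissible nonempty
... | no  empty    =
      ¬¬-map (subst (χ ≤_) (cong (n + 1 ∸_) (sym ∣S∣≡0))) (bound-n+1 n G noIsolated minimal)
  where
  ∣S∣≡0 : ∣ S ∣ ≡ 0
  ∣S∣≡0 = trans (cong ∣_∣ (Empty-unique empty)) (∣⊥∣≡0 n)

theorem3p4 : (n : ℕ) (G : Graph n) → Connected G → NoIsolated G →
    (χ a : ℕ) → IsTotalDominatorChromaticNumber G χ → IsAlpha0 G a →
    χ ≤ n + 1 ∸ a
theorem3p4 n G _ noIsolated χ _ (_ , minimal) ((S , admissible , refl) , _) =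
  decidable-stable (χ ≤? n + 1 ∸ ∣ S ∣) (admissible-bound n G noIsolated minimal admissible)
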